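{- Let $\mathbb{L}$ be a lattice with normal operators $\Box_i$ ($i\in\mathsf{Ag}$), and let $(A,X,I,\{R_i\})$ be the enriched formal context constructed from it. Then for any $a\in A$, $x\in X$, $i\in\mathsf{Ag}$: (1) $I^\uparrow[R_i^\downarrow[x]]=\{y\in X\mid\Box_ix\subseteq y\}$; (2) $I^\downarrow[R_i^\uparrow[a]]=\{b\in A\mid\Box_i^{ -1}a\subseteq b\}$; (3) $I^\downarrow[I^\uparrow[R_i^\downarrow[x]]]=\{b\in A\mid\Box_ix\cap b\neq\varnothing\}=R_i^\downarrow[x]$; (4) $I^\uparrow[I^\downarrow[R_i^\uparrow[a]]]=\{y\in X\mid\Box_i^{ -1}a\cap y\neq\varnothing\}=R_i^\uparrow[a]$.
   Context: A normal operator $\Box_i$ on a lattice $\mathbb{L}$ (with top $\top$) is monotone, preserves binary meets, and satisfies $\Box_i\top=\top$. The construction: $A$ is the set of lattice filters of $\mathbb{L}$, $X$ the set of lattice ideals, $aIx$ iff $a\cap x\neq\varnothing$, $aR_ix$ iff $\Box_iu\in a$ for some $u\in x$. $\Box_ix:=\{\Box_iu\mid u\in x\}$ and $\Box_i^{ -1}a:=\{u\in\mathbb{L}\mid\Box_iu\in a\}$. For $S\subseteq A\times X$: $S^\uparrow[B]=\{x\mid\forall a\in B,\ aSx\}$, $S^\downarrow[Y]=\{a\mid\forall x\in Y,\ aSx\}$, $S^\uparrow[a]=S^\uparrow[\{a\}]$, $S^\downarrow[x]=S^\downarrow[\{x\}]$. -}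

module Defs where

open import Level using (Level; _⊔_; suc)
open import Data.Product using (Σ; ∃; _×_; _,_)
open import Relation.Binary.Definitions using (Maximum)
open import Relation.Binary.Lattice.Bundles using (Lattice)
open import Relation.Binary.PropositionalEquality using (_≡_)

record LatticeWithTop c ℓ₁ ℓ₂ : Set (suc (c ⊔ ℓ₁ ⊔ ℓ₂)) where
  field
    lattice : Lattice c ℓ₁ ℓ₂
  open Lattice lattice public
  field
    ⊤     : Carrier
    ⊤-max : Maximum _≤_ ⊤

record NormalOperators {c ℓ₁ ℓ₂ : Level} (𝕃 : LatticeWithTop c ℓ₁ ℓ₂)
                       {g : Level} (Ag : Set g) : Set (c ⊔ ℓ₁ ⊔ ℓ₂ ⊔ g) where
  open LatticeWithTop 𝕃
  field
    □        : Ag → Carrier → Carrier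
    □-mono   : ∀ i {u v} → u ≤ v → □ i u ≤ □ i v
    □-meet   : ∀ i u v → □ i (u ∧ v) ≈ (□ i u ∧ □ i v)
    □-top    : ∀ i → □ i ⊤ ≈ ⊤

module Context {c ℓ₁ ℓ₂ : Level} (𝕃 : LatticeWithTop c ℓ₁ ℓ₂)
               {g : Level} {Ag : Set g} (N : NormalOperators 𝕃 Ag) where
  open LatticeWithTop 𝕃
  open NormalOperators N

  κ : Level
  κ = c ⊔ ℓ₁ ⊔ ℓ₂

  Subset : Set (suc κ)
  Subset = Carrier → Set κ

  record IsFilter (F : Subset) : Set κ where
    field
      nonempty : ∃ λ u → F u
      up       : ∀ {u v} → u ≤ v → F u → F v
      meet     : ∀ {u v} → F u → F v → F (u ∧ v)

  record IsIdeal (J : Subset) : Set κ where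
    field
      nonempty : ∃ λ u → J u
      down     : ∀ {u v} → v ≤ u → J u → J v
      join     : ∀ {u v} → J u → J v → J (u ∨ v)

  A : Set (suc κ)
  A = Σ Subset IsFilter

  X : Set (suc κ)
  X = Σ Subset IsIdeal

  I : A → X → Set κ
  I (a , _) (x , _) = ∃ λ u → a u × x u

  R : Ag → A → X → Set κ
  R i (a , _) (x , _) = ∃ λ u → x u × a (□ i u)

  □⊆ : Ag → Subset → Subset → Set κ
  □⊆ i x y = ∀ u → x u → y (□ i u)

  □meets : Ag → Subset → Subset → Set κ
  □meets i x b = ∃ λ u → x u × b (□ i u)

  □⁻¹ : Ag → Subset → Subset
  □⁻¹ i a u = a (□ i u)

  _⊆_ : Subset → Subset → Set κ
  s ⊆ t = ∀ u → s u → t u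

  meets : Subset → Subset → Set κ
  meets s t = ∃ λ u → s u × t u

  SetA : Set (suc (suc κ))
  SetA = A → Set (suc κ)

  SetX : Set (suc (suc κ))
  SetX = X → Set (suc κ)

  _↑[_] : (A → X → Set κ) → SetA → SetX
  (S ↑[ B ]) x = ∀ a → B a → S a x

  _↓[_] : (A → X → Set κ) → SetX → SetA
  (S ↓[ Y ]) a = ∀ x → Y x → S a x

  ｛_｝ : ∀ {T : Set (suc κ)} → T → T → Set (suc κ)
  ｛ t ｝ s = s ≡ t

  _↑⟨_⟩ : (A → X → Set κ) → A → SetX
  S ↑⟨ a ⟩ = S ↑[ ｛ a ｝ ]

  _↓⟨_⟩ : (A → X → Set κ) → X → SetA
  S ↓⟨ x ⟩ = S ↓[ ｛ x ｝ ]

  _≐_ : ∀ {ℓ} {T : Set ℓ} {k k'} → (T → Set k) → (T → Set k') → Set (ℓ ⊔ k ⊔ k')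
  P ≐ Q = ∀ t → (P t → Q t) × (Q t → P t)

module Submission where

open import Defs
open import Data.Product using (_×_; proj₁; proj₂; ∃; _,_)
open import Level using (_⊔_; Lift; lift)
open import Relation.Binary.PropositionalEquality using (refl)

-- Membership in S↓[x] (resp. S↑[a]) for a singleton just means
-- being S-related to x (resp. a), so the second halves of items (3) and (4)
-- are unfoldings of the definitions.  Items (1) and (2) are proved by testing
-- against principal filters and ideals: the principal filter ↑□ᵢu lies in
-- Rᵢ↓[x] whenever u ∈ x, and the principal ideal ↓u lies in Rᵢ↑[a] whenever
-- □ᵢu ∈ a.  The first halves of (3) and (4) follow from (1) and (2) together
-- with two canonical witnesses: the ideal generated by □ᵢx (the down-closure
-- of the image of x under the monotone map □ᵢ) and the filter □ᵢ⁻¹a (the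
-- preimage of a under a map preserving ⊤ and ∧).

module EnrichedContext {c ℓ₁ ℓ₂ g} (𝕃 : LatticeWithTop c ℓ₁ ℓ₂) {Ag : Set g}
    (N : NormalOperators 𝕃 Ag) where
  open LatticeWithTop 𝕃 renaming (refl to ≤-refl)
  open NormalOperators N
  open Context 𝕃 N

  ≐-sym : ∀ {t k k'} {T : Set t} {P : T → Set k} {Q : T → Set k'} →
          P ≐ Q → Q ≐ P
  ≐-sym P≐Q t = let (to , from) = P≐Q t in from , to

  ≐-trans : ∀ {t k k' k''} {T : Set t}
              {P : T → Set k} {Q : T → Set k'} {S : T → Set k''} →
            P ≐ Q → Q ≐ S → P ≐ S
  ≐-trans P≐Q Q≐S t =
    let (P→Q , Q→P) = P≐Q t ; (Q→S , S→Q) = Q≐S t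
    in (λ p → Q→S (P→Q p)) , (λ s → Q→P (S→Q s))

  meets-sym : ∀ {s t} → meets s t → meets t s
  meets-sym (u , su , tu) = u , tu , su

  ↓-singleton : (S : A → X → Set κ) (x : X) → (S ↓⟨ x ⟩) ≐ (λ a → S a x)
  ↓-singleton S x a = (λ h → h x refl) , (λ { aSx _ refl → aSx })

  ↑-singleton : (S : A → X → Set κ) (a : A) → (S ↑⟨ a ⟩) ≐ (λ x → S a x)
  ↑-singleton S a x = (λ h → h a refl) , (λ { aSx _ refl → aSx })

  filter-⊤ : (F : A) → proj₁ F ⊤
  filter-⊤ (F , isF) =
    let (w , Fw) = IsFilter.nonempty isF in IsFilter.up isF (⊤-max w) Fw

  principalFilter : Carrier → A
  principalFilter u = (λ v → Lift κ (u ≤ v)) , record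
    { nonempty = u , lift ≤-refl
    ; up       = λ v≤w (lift u≤v) → lift (trans u≤v v≤w)
    ; meet     = λ (lift u≤v) (lift u≤w) → lift (∧-greatest u≤v u≤w) }

  principalIdeal : Carrier → X
  principalIdeal u = (λ v → Lift κ (v ≤ u)) , record
    { nonempty = u , lift ≤-refl
    ; down     = λ w≤v (lift v≤u) → lift (trans w≤v v≤u)
    ; join     = λ (lift v≤u) (lift w≤u) → lift (∨-least v≤u w≤u) }

  Monotone : (Carrier → Carrier) → Set (c ⊔ ℓ₂)
  Monotone f = ∀ {u v} → u ≤ v → f u ≤ f v

  imageIdeal : (f : Carrier → Carrier) → Monotone f → X → X
  imageIdeal f f-mono (x , isI) = (λ v → ∃ λ u → x u × Lift κ (v ≤ f u)) , record
    { nonempty = let (u , xu) = IsIdeal.nonempty isI in f u , u , xu , lift ≤-refl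
    ; down     = λ w≤v (u , xu , lift v≤fu) → u , xu , lift (trans w≤v v≤fu)
    ; join     = λ (u₁ , xu₁ , lift v≤fu₁) (u₂ , xu₂ , lift w≤fu₂) →
        u₁ ∨ u₂ , IsIdeal.join isI xu₁ xu₂ ,
        lift (∨-least (trans v≤fu₁ (f-mono (x≤x∨y u₁ u₂)))
                      (trans w≤fu₂ (f-mono (y≤x∨y u₁ u₂)))) }

  preimageFilter : (f : Carrier → Carrier) → Monotone f → ⊤ ≤ f ⊤ →
                   (∀ u v → f u ∧ f v ≤ f (u ∧ v)) → A → A
  preimageFilter f f-mono f-top f-meet (a , isF) = (λ u → a (f u)) , record
    { nonempty = ⊤ , IsFilter.up isF f-top (filter-⊤ (a , isF))
    ; up       = λ u≤v afu → IsFilter.up isF (f-mono u≤v) afu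
    ; meet     = λ afu afv → IsFilter.up isF (f-meet _ _) (IsFilter.meet isF afu afv) }

  □Ideal : Ag → X → X
  □Ideal i = imageIdeal (□ i) (□-mono i)

  □⁻¹Filter : Ag → A → A
  □⁻¹Filter i = preimageFilter (□ i) (□-mono i)
    (reflexive (Eq.sym (□-top i))) (λ u v → reflexive (Eq.sym (□-meet i u v)))

  I↑R↓≐□⊆ : ∀ i (x : X) → (I ↑[ R i ↓⟨ x ⟩ ]) ≐ (λ y → □⊆ i (proj₁ x) (proj₁ y))
  I↑R↓≐□⊆ i (x , isIx) (y , isIy) = to , from
    where
    to : (I ↑[ R i ↓⟨ x , isIx ⟩ ]) (y , isIy) → □⊆ i x y
    to h u xu =
      let ↑□u = principalFilter (□ i u)
          (v , lift □u≤v , yv) = h ↑□u (proj₂ (↓-singleton (R i) _ ↑□u) (u , xu , lift ≤-refl))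
      in IsIdeal.down isIy □u≤v yv
    from : □⊆ i x y → (I ↑[ R i ↓⟨ x , isIx ⟩ ]) (y , isIy)
    from □x⊆y b bRx =
      let (u , xu , b□u) = proj₁ (↓-singleton (R i) _ b) bRx in □ i u , b□u , □x⊆y u xu

  I↓R↑≐□⁻¹⊆ : ∀ i (a : A) → (I ↓[ R i ↑⟨ a ⟩ ]) ≐ (λ b → □⁻¹ i (proj₁ a) ⊆ proj₁ b)
  I↓R↑≐□⁻¹⊆ i (a , isFa) (b , isFb) = to , from
    where
    to : (I ↓[ R i ↑⟨ a , isFa ⟩ ]) (b , isFb) → □⁻¹ i a ⊆ b
    to h u a□u =
      let ↓u = principalIdeal u
          (v , bv , lift v≤u) = h ↓u (proj₂ (↑-singleton (R i) _ ↓u) (u , lift ≤-refl , a□u))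
      in IsFilter.up isFb v≤u bv
    from : □⁻¹ i a ⊆ b → (I ↓[ R i ↑⟨ a , isFa ⟩ ]) (b , isFb)
    from □⁻¹a⊆b y aRy =
      let (u , yu , a□u) = proj₁ (↑-singleton (R i) _ y) aRy in u , □⁻¹a⊆b u a□u , yu

  -- Item (3), first half: the Galois closure of Rᵢ↓[x] consists of the filters
  -- meeting □ᵢx.  The ideal generated by □ᵢx is the decisive test object.
  I↓I↑R↓≐□meets : ∀ i (x : X) →
                  (I ↓[ I ↑[ R i ↓⟨ x ⟩ ] ]) ≐ (λ b → □meets i (proj₁ x) (proj₁ b))
  I↓I↑R↓≐□meets i x (b , isFb) = to , from
    where
    □x⊆□Ideal : □⊆ i (proj₁ x) (proj₁ (□Ideal i x))
    □x⊆□Ideal u xu = u , xu , lift ≤-refl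

    to : (I ↓[ I ↑[ R i ↓⟨ x ⟩ ] ]) (b , isFb) → □meets i (proj₁ x) b
    to h =
      let (v , bv , u , xu , lift v≤□u) =
            h (□Ideal i x) (proj₂ (I↑R↓≐□⊆ i x (□Ideal i x)) □x⊆□Ideal)
      in u , xu , IsFilter.up isFb v≤□u bv
    from : □meets i (proj₁ x) b → (I ↓[ I ↑[ R i ↓⟨ x ⟩ ] ]) (b , isFb)
    from (u , xu , b□u) y hy = □ i u , b□u , proj₁ (I↑R↓≐□⊆ i x y) hy u xu

  □meets≐R↓ : ∀ i (x : X) → (λ b → □meets i (proj₁ x) (proj₁ b)) ≐ (R i ↓⟨ x ⟩)
  □meets≐R↓ i x = ≐-sym (↓-singleton (R i) x)

  -- Item (4), first half: the Galois closure of Rᵢ↑[a] consists of the ideals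
  -- meeting □ᵢ⁻¹a.  The filter □ᵢ⁻¹a is the decisive test object.
  I↑I↓R↑≐meets□⁻¹ : ∀ i (a : A) →
                    (I ↑[ I ↓[ R i ↑⟨ a ⟩ ] ]) ≐ (λ y → meets (□⁻¹ i (proj₁ a)) (proj₁ y))
  I↑I↓R↑≐meets□⁻¹ i a y = to , from
    where
    □⁻¹a : A
    □⁻¹a = □⁻¹Filter i a

    to : (I ↑[ I ↓[ R i ↑⟨ a ⟩ ] ]) y → meets (□⁻¹ i (proj₁ a)) (proj₁ y)
    to h = h □⁻¹a (proj₂ (I↓R↑≐□⁻¹⊆ i a □⁻¹a) (λ u a□u → a□u))
    from : meets (□⁻¹ i (proj₁ a)) (proj₁ y) → (I ↑[ I ↓[ R i ↑⟨ a ⟩ ] ]) y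
    from (u , a□u , yu) b hb = u , proj₁ (I↓R↑≐□⁻¹⊆ i a b) hb u a□u , yu

  meets□⁻¹≐R↑ : ∀ i (a : A) → (λ y → meets (□⁻¹ i (proj₁ a)) (proj₁ y)) ≐ (R i ↑⟨ a ⟩)
  meets□⁻¹≐R↑ i a =
    ≐-trans (λ y → meets-sym , meets-sym) (≐-sym (↑-singleton (R i) a))

lemmaA15 : ∀ {c ℓ₁ ℓ₂ g} (𝕃 : LatticeWithTop c ℓ₁ ℓ₂) {Ag : Set g}
    (N : NormalOperators 𝕃 Ag) →
    let open Context 𝕃 N in
    (a : A) (x : X) (i : Ag) →
    ((I ↑[ R i ↓⟨ x ⟩ ]) ≐ (λ y → □⊆ i (proj₁ x) (proj₁ y)))
    × ((I ↓[ R i ↑⟨ a ⟩ ]) ≐ (λ b → □⁻¹ i (proj₁ a) ⊆ proj₁ b))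
    × ((I ↓[ I ↑[ R i ↓⟨ x ⟩ ] ]) ≐ (λ b → □meets i (proj₁ x) (proj₁ b)))
    × ((λ b → □meets i (proj₁ x) (proj₁ b)) ≐ (R i ↓⟨ x ⟩))
    × ((I ↑[ I ↓[ R i ↑⟨ a ⟩ ] ]) ≐ (λ y → meets (□⁻¹ i (proj₁ a)) (proj₁ y)))
    × ((λ y → meets (□⁻¹ i (proj₁ a)) (proj₁ y)) ≐ (R i ↑⟨ a ⟩))
lemmaA15 𝕃 N a x i =
    I↑R↓≐□⊆ i x
  , I↓R↑≐□⁻¹⊆ i a
  , I↓I↑R↓≐□meets i x
  , □meets≐R↓ i x
  , I↑I↓R↑≐meets□⁻¹ i a
  , meets□⁻¹≐R↑ i a
  where open EnrichedContext 𝕃 N
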